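{- Let $H$ be a graph such that $d^*(H)+1=c^*(H)=\Delta(H)$. Let $v\in V(H)$ with $\deg(v)=\Delta(H)$ and let $S=N(v)$. Then there exists $u\in S$ such that for every $v'\in V(H)$, $S\setminus\{u\}\subseteq N(v')$ implies $N(v')\subseteq N(v)$.
   Context: Graphs may have loops; $N(v)$ is the neighborhood of $v$ and $\deg(v)=|N(v)|$ (a loop contributes 1); $\Delta(H)$ is the maximum degree. Vertices $u,v$ are incomparable if neither $N(u)\subseteq N(v)$ nor $N(v)\subseteq N(u)$. A set $S$ has a common neighbor in $L$ if some vertex of $L$ is adjacent to all of $S$. $c^*(H)$ is the maximum over $L\subseteq V(H)$ of the largest size of an inclusion-minimal $S\subseteq V(H)$ without a common neighbor in $L$. A lower bound structure of order $d$: a set $L\subseteq V(H)$, distinct $x_1,\dots,x_d$, not necessarily distinct $x_1',\dots,x_d'$ with $x_i,x_i'$ incomparable, $\bigcap_i N(x_i)\cap L=\emptyset$, and $\bigcap_i N(y_i)\cap L\ne\emptyset$ for every choice $y_i\in\{x_i,x_i'\}$ with at least one $y_i=x_i'$. $d^*(H)$ is the largest order of a lower bound structure in $H$. -}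

module Defs where

open import Data.Nat using (ℕ; _≤_)
open import Data.Bool using (Bool; true; false)
open import Data.Fin using (Fin)
open import Data.Fin.Subset using (Subset; _∈_; _⊆_; _⊂_; ∣_∣)
open import Data.Vec using (tabulate)
open import Data.Product using (Σ; ∃; _×_)
open import Relation.Binary.PropositionalEquality using (_≡_)
open import Relation.Nullary using (¬_)
open import Function.Definitions using (Injective)

-- A finite graph (loops allowed) on vertex set Fin n,
-- given by a symmetric Boolean adjacency relation.
record Graph (n : ℕ) : Set where
  field
    adj : Fin n → Fin n → Bool
    adj-sym : ∀ u v → adj u v ≡ adj v u
open Graph public

module _ {n : ℕ} (H : Graph n) where

  -- neighbourhood N(v); a loop at v puts v in N(v)
  N : Fin n → Subset n
  N v = tabulate (adj H v)

  -- deg(v) = |N(v)|  (a loop contributes 1)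
  deg : Fin n → ℕ
  deg v = ∣ N v ∣

  IsMaxDegree : ℕ → Set
  IsMaxDegree k = (∃ λ v → deg v ≡ k) × (∀ v → deg v ≤ k)

  Incomparable : Fin n → Fin n → Set
  Incomparable u v = ¬ (N u ⊆ N v) × ¬ (N v ⊆ N u)

  HasCommonNbr : Subset n → Subset n → Set
  HasCommonNbr L S = ∃ λ w → w ∈ L × S ⊆ N w

  MinimalNoCommonNbr : Subset n → Subset n → Set
  MinimalNoCommonNbr L S =
    ¬ HasCommonNbr L S × (∀ T → T ⊂ S → HasCommonNbr L T)

  IsCStar : ℕ → Set
  IsCStar k =
    (∃ λ L → ∃ λ S → MinimalNoCommonNbr L S × ∣ S ∣ ≡ k)
    × (∀ L S → MinimalNoCommonNbr L S → ∣ S ∣ ≤ k)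

  choose : ∀ {d} → (Fin d → Fin n) → (Fin d → Fin n) → (Fin d → Bool) → Fin d → Fin n
  choose x x' c i with c i
  ... | false = x i
  ... | true  = x' i

  record LowerBoundStructure (d : ℕ) : Set where
    field
      L   : Subset n
      x   : Fin d → Fin n
      x'  : Fin d → Fin n
      x-distinct   : Injective _≡_ _≡_ x
      incomparable : ∀ i → Incomparable (x i) (x' i)
      empty-int    : ¬ (∃ λ w → w ∈ L × (∀ i → w ∈ N (x i)))
      nonempty-int : ∀ (c : Fin d → Bool) → (∃ λ i → c i ≡ true) →
                     ∃ λ w → w ∈ L × (∀ i → w ∈ N (choose x x' c i))

  IsDStar : ℕ → Set
  IsDStar k = LowerBoundStructure k × (∀ d → LowerBoundStructure d → d ≤ k)

-- Call w an escape from N(v) at u if N(v) - u ⊆ N(w) but N(w) ⊈ N(v). If v has maximum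
-- degree, an escape w at u ∈ N(v) cannot see u, for otherwise N(v) ⊂ N(w). Suppose every
-- u ∈ N(v) had an escape w_u. With L = N(v), x_u = w_u and x'_u = v we get a lower bound
-- structure of order deg(v) = Δ: the w_u are incomparable with v, ⋂ N(w_u) misses every
-- u ∈ L, and as soon as one y_u is v, the vertex u itself lies in all N(y_u').
-- Hence Δ ≤ d* = Δ - 1, a contradiction.
module Submission where

open import Defs
open import Data.Nat using (ℕ; suc; s≤s; _≤_; _<_)
open import Data.Nat.Properties using (≤-trans; ≤-reflexive; 1+n≰n)
open import Data.Bool using (true; false)
open import Data.Fin using (Fin; zero; suc; _≟_)
open import Data.Fin.Properties using (any?; suc-injective)
open import Data.Fin.Subset using (Subset; _∈_; _∉_; _⊆_; _⊈_; _-_; ∣_∣; inside; outside)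
open import Data.Fin.Subset.Properties using (_∈?_; _⊆?_; p⊂q⇒∣p∣<∣q∣; x∈p∧x≢y⇒x∈p-y)
open import Data.Vec using (_∷_; here; there)
open import Data.Product using (∃; _×_; _,_; proj₁; proj₂)
open import Relation.Nullary using (¬_; yes; no; ¬?; contradiction)
open import Relation.Nullary.Decidable using (_×-dec_; decidable-stable)
open import Relation.Unary using (Decidable)
open import Relation.Binary.PropositionalEquality using (_≡_; _≢_; refl; sym; trans; cong; subst)
open import Function.Definitions using (Injective)

module _ {n : ℕ} where

  ⊈⇒∃∉ : {p q : Subset n} → p ⊈ q → ∃ λ x → x ∈ p × x ∉ q
  ⊈⇒∃∉ {p} {q} p⊈q with any? (λ x → (x ∈? p) ×-dec ¬? (x ∈? q))
  ... | yes witness = witness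
  ... | no ¬witness = contradiction (λ {x} → p∋x⇒q∋x x) p⊈q
    where
    p∋x⇒q∋x : ∀ x → x ∈ p → x ∈ q
    p∋x⇒q∋x x x∈p = decidable-stable (x ∈? q) (λ x∉q → ¬witness (x , x∈p , x∉q))

enumerate : ∀ {n} (p : Subset n) → Fin ∣ p ∣ → Fin n
enumerate (outside ∷ p) i       = suc (enumerate p i)
enumerate (inside  ∷ p) zero    = zero
enumerate (inside  ∷ p) (suc i) = suc (enumerate p i)

enumerate-∈ : ∀ {n} (p : Subset n) (i : Fin ∣ p ∣) → enumerate p i ∈ p
enumerate-∈ (outside ∷ p) i       = there (enumerate-∈ p i)
enumerate-∈ (inside  ∷ p) zero    = here
enumerate-∈ (inside  ∷ p) (suc i) = there (enumerate-∈ p i)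

enumerate-injective : ∀ {n} (p : Subset n) → Injective _≡_ _≡_ (enumerate p)
enumerate-injective (outside ∷ p) eq = enumerate-injective p (suc-injective eq)
enumerate-injective (inside  ∷ p) {zero}  {zero}  _  = refl
enumerate-injective (inside  ∷ p) {suc i} {suc j} eq =
  cong suc (enumerate-injective p (suc-injective eq))

enumerate-surjective : ∀ {n} (p : Subset n) {x : Fin n} → x ∈ p →
                       ∃ λ i → enumerate p i ≡ x
enumerate-surjective (outside ∷ p) {suc x} (there x∈p) =
  let i , eq = enumerate-surjective p x∈p in i , cong suc eq
enumerate-surjective (inside  ∷ p) {zero}  here        = zero , refl
enumerate-surjective (inside  ∷ p) {suc x} (there x∈p) =
  let i , eq = enumerate-surjective p x∈p in suc i , cong suc eq

module _ {n : ℕ} (H : Graph n) where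

  Escape : Fin n → Fin n → Fin n → Set
  Escape v u w = (N H v - u ⊆ N H w) × N H w ⊈ N H v

  escape? : ∀ v u → Decidable (Escape v u)
  escape? v u w = (N H v - u ⊆? N H w) ×-dec ¬? (N H w ⊆? N H v)

  escape⇒∉ : ∀ {v u w} → (∀ x → deg H x ≤ deg H v) → u ∈ N H v →
             Escape v u w → u ∉ N H w
  escape⇒∉ {v} {u} {w} maximal u∈Nv (Nv-u⊆Nw , Nw⊈Nv) u∈Nw =
    1+n≰n (≤-trans (p⊂q⇒∣p∣<∣q∣ (Nv⊆Nw , ⊈⇒∃∉ Nw⊈Nv)) (maximal w))
    where
    Nv⊆Nw : N H v ⊆ N H w
    Nv⊆Nw {x} x∈Nv with x ≟ u
    ... | yes refl = u∈Nw
    ... | no x≢u  = Nv-u⊆Nw (x∈p∧x≢y⇒x∈p-y x∈Nv x≢u)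

  escapes⇒LowerBoundStructure :
    ∀ v → (∀ u → u ∈ N H v → ∃ λ w → Escape v u w × u ∉ N H w) →
    LowerBoundStructure H (deg H v)
  escapes⇒LowerBoundStructure v escapes = record
    { L            = N H v
    ; x            = x
    ; x'           = λ _ → v
    ; x-distinct   = x-distinct
    ; incomparable = λ i → proj₂ (escape i) , λ Nv⊆ → misses-own i (Nv⊆ (e∈ i))
    ; empty-int    = λ (w , w∈Nv , w∈all) →
        let k , ek≡w = enumerate-surjective (N H v) w∈Nv
        in misses-own k (subst (_∈ N H (x k)) (sym ek≡w) (w∈all k))
    ; nonempty-int = λ c (i , cᵢ) → e i , e∈ i , sees-chosen c i cᵢ
    }
    where
    e : Fin (deg H v) → Fin n
    e = enumerate (N H v)

    e∈ : ∀ i → e i ∈ N H v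
    e∈ = enumerate-∈ (N H v)

    x : Fin (deg H v) → Fin n
    x i = proj₁ (escapes (e i) (e∈ i))

    escape : ∀ i → Escape v (e i) (x i)
    escape i = proj₁ (proj₂ (escapes (e i) (e∈ i)))

    misses-own : ∀ i → e i ∉ N H (x i)
    misses-own i = proj₂ (proj₂ (escapes (e i) (e∈ i)))

    sees-others : ∀ i j → i ≢ j → e i ∈ N H (x j)
    sees-others i j i≢j =
      proj₁ (escape j) (x∈p∧x≢y⇒x∈p-y (e∈ i) (λ eq → i≢j (enumerate-injective (N H v) eq)))

    x-distinct : Injective _≡_ _≡_ x
    x-distinct {i} {j} xi≡xj with i ≟ j
    ... | yes i≡j = i≡j
    ... | no  i≢j = contradiction (subst (e i ∈_) (cong (N H) (sym xi≡xj)) (sees-others i j i≢j))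
                                  (misses-own i)

    sees-chosen : ∀ c i → c i ≡ true → ∀ j → e i ∈ N H (choose H x (λ _ → v) c j)
    sees-chosen c i cᵢ j with c j in cⱼ
    ... | true  = e∈ i
    ... | false = sees-others i j λ { refl → contradiction (trans (sym cᵢ) cⱼ) λ () }

  ∃-unescapable : ∀ v → (∀ x → deg H x ≤ deg H v) →
                  (∀ k → LowerBoundStructure H k → k < deg H v) →
                  ∃ λ u → u ∈ N H v × (∀ w → ¬ Escape v u w)
  ∃-unescapable v maximal small
    with any? (λ u → (u ∈? N H v) ×-dec ¬? (any? (escape? v u)))
  ... | yes (u , u∈Nv , ¬escape) = u , u∈Nv , λ w esc → ¬escape (w , esc)
  ... | no  ¬unescapable =
    contradiction (small (deg H v) (escapes⇒LowerBoundStructure v escapes)) (1+n≰n {deg H v})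
    where
    escapes : ∀ u → u ∈ N H v → ∃ λ w → Escape v u w × u ∉ N H w
    escapes u u∈Nv =
      let w , esc = decidable-stable (any? (escape? v u))
                                     (λ ¬esc → ¬unescapable (u , u∈Nv , ¬esc))
      in w , esc , escape⇒∉ maximal u∈Nv esc

lemma31 : ∀ {n} (H : Graph n) (d c Δ : ℕ) →
          IsDStar H d → IsCStar H c → IsMaxDegree H Δ →
          suc d ≡ c → c ≡ Δ →
          (v : Fin n) → deg H v ≡ Δ →
          ∃ λ u → u ∈ N H v ×
            (∀ v' → (N H v - u) ⊆ N H v' → N H v' ⊆ N H v)
lemma31 H d c Δ (_ , d*-bound) _ (_ , Δ-bound) 1+d≡c c≡Δ v deg[v]≡Δ =
  let u , u∈Nv , unescapable = ∃-unescapable H v maximal small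
  in u , u∈Nv , λ v' Nv-u⊆Nv' →
       decidable-stable (N H v' ⊆? N H v) (λ Nv'⊈Nv → unescapable v' (Nv-u⊆Nv' , Nv'⊈Nv))
  where
  Δ≡deg[v] : Δ ≡ deg H v
  Δ≡deg[v] = sym deg[v]≡Δ

  maximal : ∀ x → deg H x ≤ deg H v
  maximal x = ≤-trans (Δ-bound x) (≤-reflexive Δ≡deg[v])

  small : ∀ k → LowerBoundStructure H k → k < deg H v
  small k lbs =
    ≤-trans (s≤s (d*-bound k lbs)) (≤-reflexive (trans 1+d≡c (trans c≡Δ Δ≡deg[v])))
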